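{- Let $G$ be a connected graph with cut decomposition $(X,\mathcal{C})$, and let $x$ be a node of $X$. Suppose that the survivor is restricted to the vertices of $G[\Lambda_X(x)]$, i.e. its position is always in $\bigcup_{y\in\Lambda_X(x)} C_y$. Then $\mathrm{load}(x)$ lazy zombies, starting from any vertices of $G$, can capture the survivor in at most $\mathrm{time}(x)$ rounds.
   Context: Lazy zombies and survivor game on a connected graph $G$: each round, first every lazy zombie either stays at its current vertex $u$ or moves to a neighbour of $u$ lying on a shortest path in $G$ from $u$ to the survivor's current vertex; then the survivor stays or moves to an adjacent vertex; full information; capture means a lazy zombie occupies the survivor's vertex. $\delta(G)$ denotes the diameter of $G$. A cut decomposition of $G$ is a pair $(X,\mathcal{C})$ where $X$ is a rooted tree and $\mathcal{C}=\{C_x\subseteq V(G): x\in V(X)\}$ such that: every $v\in V(G)$ lies in $C_x$ for a unique $x$; for every edge $uv$ of $G$ there are $x,y$ with $u\in C_x$, $v\in C_y$ and $x$ an ancestor of $y$ (a node is its own ancestor); for every non-leaf node $y$, $C_y$ is a cut set of the induced subgraph $G[\Lambda_X(y)] := G[\bigcup_{x\in\Lambda_X(y)} C_x]$, where $\Lambda_X(y)$ is the subtree of $X$ rooted at $y$. Define $\mathrm{load}(x)=|C_x|$ if $x$ is a leaf and $\mathrm{load}(x)=|C_x|+\max_y \mathrm{load}(y)$ otherwise ($y$ ranging over children of $x$); $\mathrm{time}(x)=|C_x|(\delta(G)-1)+1$ if $x$ is a leaf and $\mathrm{time}(x)=\max_y \mathrm{time}(y)\cdot(|C_x|(\delta(G)-1)+1)$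 otherwise. -}

module Defs where

open import Data.Nat using (ℕ; zero; suc; _+_; _*_; _∸_; _⊔_; _≤_)
open import Data.Fin using (Fin; zero; suc)
open import Data.Fin.Subset using (Subset; _∈_; _∉_; ∣_∣)
open import Data.Bool using (Bool; true; false)
open import Data.Product using (Σ; ∃; _×_; _,_)
open import Data.Sum using (_⊎_)
open import Relation.Binary.PropositionalEquality using (_≡_)
open import Relation.Nullary using (¬_)

record Graph (n : ℕ) : Set where
  field
    adj    : Fin n → Fin n → Bool
    sym    : ∀ u v → adj u v ≡ adj v u
    irrefl : ∀ u → adj u u ≡ false

module _ {n : ℕ} (G : Graph n) where
  open Graph G

  Edge : Fin n → Fin n → Set
  Edge u v = adj u v ≡ true

  data Walk : Fin n → Fin n → ℕ → Set where
    nil  : ∀ {u} → Walk u u 0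
    cons : ∀ {u w v k} → Edge u w → Walk w v k → Walk u v (suc k)

  data WalkIn (P : Fin n → Set) : Fin n → Fin n → Set where
    nilP  : ∀ {u} → P u → WalkIn P u u
    consP : ∀ {u w v} → P u → Edge u w → WalkIn P w v → WalkIn P u v

  Connected : Set
  Connected = ∀ u v → ∃ λ k → Walk u v k

  Dist : Fin n → Fin n → ℕ → Set
  Dist u v d = Walk u v d × (∀ k → Walk u v k → d ≤ k)

  Diameter : ℕ → Set
  Diameter D = (∀ u v d → Dist u v d → d ≤ D)
             × Σ (Fin n) λ u → Σ (Fin n) λ v → Dist u v D

data CTree (n : ℕ) : Set where
  node : Subset n → (k : ℕ) → (Fin k → CTree n) → CTree n

bag : ∀ {n} → CTree n → Subset n
bag (node C _ _) = C

arity : ∀ {n} → CTree n → ℕ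
arity (node _ k _) = k

-- nodes of the tree, as paths from the root
data Pos {n : ℕ} : CTree n → Set where
  here  : ∀ {C k f} → Pos (node C k f)
  child : ∀ {C k f} (i : Fin k) → Pos (f i) → Pos (node C k f)

sub : ∀ {n} (t : CTree n) → Pos t → CTree n
sub t here = t
sub (node _ _ f) (child i p) = sub (f i) p

C[_] : ∀ {n} {t : CTree n} → Pos t → Subset n
C[_] {t = t} p = bag (sub t p)

data Anc {n : ℕ} : {t : CTree n} → Pos t → Pos t → Set where
  anc-here  : ∀ {C k f} {q : Pos (node C k f)} → Anc here q
  anc-child : ∀ {C k f} {i : Fin k} {p q : Pos (f i)} →
              Anc p q → Anc {t = node C k f} (child i p) (child i q)

InΛ : ∀ {n} {t : CTree n} → Pos t → Fin n → Set
InΛ {t = t} x v = Σ (Pos t) λ q → Anc x q × v ∈ C[ q ]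

record IsCutDecomposition {n : ℕ} (G : Graph n) (t : CTree n) : Set where
  field
    unique-bag : ∀ v → Σ (Pos t) λ p → v ∈ C[ p ] × (∀ q → v ∈ C[ q ] → q ≡ p)
    edge-anc   : ∀ u v → Edge G u v →
                 Σ (Pos t) λ p → Σ (Pos t) λ q →
                   u ∈ C[ p ] × v ∈ C[ q ] × (Anc p q ⊎ Anc q p)
    cut        : ∀ (y : Pos t) → 0 Data.Nat.< arity (sub t y) →
                 Σ (Fin n) λ u → Σ (Fin n) λ v →
                   let P = λ w → InΛ y w × w ∉ C[ y ] in
                   P u × P v × ¬ WalkIn G P u v

maxF : (k : ℕ) → (Fin k → ℕ) → ℕ
maxF zero    f = 0
maxF (suc k) f = f zero ⊔ maxF k (λ i → f (suc i))

load : ∀ {n} → CTree n → ℕ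
load (node C zero    f) = ∣ C ∣
load (node C (suc k) f) = ∣ C ∣ + maxF (suc k) (λ i → load (f i))

-- D is the diameter δ(G); δ(G) - 1 is truncated subtraction
time : ∀ {n} → ℕ → CTree n → ℕ
time D (node C zero    f) = ∣ C ∣ * (D ∸ 1) + 1
time D (node C (suc k) f) = maxF (suc k) (λ i → time D (f i)) * (∣ C ∣ * (D ∸ 1) + 1)

module _ {n : ℕ} (G : Graph n) where

  LazyStep : Fin n → Fin n → Fin n → Set
  LazyStep s z z' = z' ≡ z ⊎ (Edge G z z' × ∃ λ d → Dist G z' s d × Dist G z s (suc d))

  SurvStep : Fin n → Fin n → Set
  SurvStep s s' = s' ≡ s ⊎ Edge G s s'

  Captured : ∀ {m} → (Fin m → Fin n) → Fin n → Set
  Captured Z s = ∃ λ i → Z i ≡ s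

  Win : (R : Fin n → Set) (m : ℕ) → ℕ → (Fin m → Fin n) → Fin n → Set
  Win R m zero    Z s = Captured Z s
  Win R m (suc k) Z s =
    Captured Z s ⊎
    Σ (Fin m → Fin n) λ Z' → (∀ i → LazyStep s (Z i) (Z' i)) ×
      (Captured Z' s ⊎ (∀ s' → SurvStep s s' → R s' → Win R m k Z' s'))

-- Every node of the subtree gets a squad with one zombie for each vertex c of its bag, and that
-- zombie moves along a shortest path to the survivor only in rounds where the survivor stands
-- on c.  Its distance to c is at most D, so after at most D − 1 such moves its next move is a
-- capture.  The children of a node can reuse the same zombies: confined to G[Λ(x)],
-- the survivor cannot pass from the subtree of one child to that of another without stepping
-- on the bag of an ancestor.  Progress is measured by a lexicographic potential along the path
-- from x to the bag of the survivor: each node contributes the total of (distance − 1) over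
-- its squad, weighted by the time its children need.  Every round ends in a capture or lowers
-- the potential, which is always below time(x).
module Submission where

open import Defs
open import Data.Nat using (ℕ; zero; suc; _+_; _*_; _∸_; _≤_; _<_; z≤n; s≤s)
open import Data.Nat.Properties
open import Data.Fin using (Fin; zero; suc; toℕ; fromℕ<) renaming (_≟_ to _≟ᶠ_)
open import Data.Fin.Properties using (toℕ<n; fromℕ<-toℕ; toℕ-fromℕ<; any?)
open import Data.Fin.Subset using (Subset; _∈_; ∣_∣)
open import Data.Vec using ([]; _∷_) renaming (there to thereᵛ)
open import Data.List using (List; length; map) renaming ([] to []ˡ; _∷_ to _∷ˡ_)
open import Data.List.Properties using (length-map)
open import Data.List.Relation.Unary.Any using (here; there)
open import Data.List.Membership.Propositional using () renaming (_∈_ to _∈ˡ_)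
open import Data.List.Membership.Propositional.Properties using (∈-map⁺)
open import Data.Bool using (true; false)
open import Data.Bool.Properties using () renaming (_≟_ to _≟ᵇ_)
open import Data.Product using (Σ; ∃; _×_; _,_; proj₁; proj₂)
open import Data.Sum using (_⊎_; inj₁; inj₂; [_,_]′; map₁)
open import Data.Empty using (⊥-elim)
open import Function using (_∘_)
open import Relation.Nullary using (¬_; Dec; yes; no)
open import Relation.Nullary.Decidable using (_×-dec_)
open import Relation.Unary using (Decidable)
open import Relation.Binary.PropositionalEquality

lex-< : ∀ {a b r t} r′ → a < b → r < t → a * t + r < b * t + r′
lex-< {a} {b} {r} {t} r′ a<b r<t = begin-strict
  a * t + r  <⟨ +-monoʳ-< (a * t) r<t ⟩
  a * t + t  ≡⟨ +-comm (a * t) t ⟩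
  suc a * t  ≤⟨ *-monoˡ-≤ t a<b ⟩
  b * t      ≤⟨ m≤m+n (b * t) r′ ⟩
  b * t + r′ ∎
  where open ≤-Reasoning

lex-bound : ∀ {a b r t} → a ≤ b → r < t → a * t + r < t * (b + 1)
lex-bound {a} {b} {r} {t} a≤b r<t = begin-strict
  a * t + r      <⟨ lex-< 0 (s≤s a≤b) r<t ⟩
  suc b * t + 0  ≡⟨ +-identityʳ (suc b * t) ⟩
  suc b * t      ≡⟨ cong (_* t) (+-comm 1 b) ⟩
  (b + 1) * t    ≡⟨ *-comm (b + 1) t ⟩
  t * (b + 1)    ∎
  where open ≤-Reasoning

maxF-upper : ∀ k (f : Fin k → ℕ) i → f i ≤ maxF k f
maxF-upper (suc k) f zero    = m≤m⊔n _ _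
maxF-upper (suc k) f (suc i) = ≤-trans (maxF-upper k (f ∘ suc) i) (m≤n⊔m _ _)

module _ {p} {P : ℕ → Set p} (P? : Decidable P) where

  private
    least-upTo : ∀ k → (∃ λ d → P d × (∀ j → P j → d ≤ j)) ⊎ (∀ j → j ≤ k → ¬ P j)
    least-upTo zero with P? 0
    ... | yes p0 = inj₁ (0 , p0 , λ _ _ → z≤n)
    ... | no ¬p0 = inj₂ λ { .zero z≤n → ¬p0 }
    least-upTo (suc k) with least-upTo k | P? (suc k)
    ... | inj₁ least | _        = inj₁ least
    ... | inj₂ none  | yes pk   = inj₁ (suc k , pk , λ j pj → ≰⇒> (λ j≤k → none j j≤k pj))
    ... | inj₂ none  | no ¬pk   = inj₂ λ j j≤1+k →
      [ (λ j<1+k → none j (≤-pred j<1+k)) , (λ { refl → ¬pk }) ]′ (m≤n⇒m<n∨m≡n j≤1+k)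

  least-witness : ∀ {k} → P k → ∃ λ d → P d × (∀ j → P j → d ≤ j)
  least-witness {k} pk with least-upTo k
  ... | inj₁ least = least
  ... | inj₂ none  = ⊥-elim (none k ≤-refl pk)

module _ {A : Set} where

  shift : ℕ → (ℕ → A) → ℕ → A
  shift L Z j = Z (L + j)

  splice : ℕ → (ℕ → A) → (ℕ → A) → ℕ → A
  splice zero    Z g i       = g i
  splice (suc L) Z g zero    = Z zero
  splice (suc L) Z g (suc i) = splice L (Z ∘ suc) g i

  splice-< : ∀ L Z g {i} → i < L → splice L Z g i ≡ Z i
  splice-< (suc L) Z g {zero}  _         = refl
  splice-< (suc L) Z g {suc i} (s≤s i<L) = splice-< L (Z ∘ suc) g i<L

  shift-splice : ∀ L Z g → shift L (splice L Z g) ≗ g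
  shift-splice zero    Z g j = refl
  shift-splice (suc L) Z g j = shift-splice L (Z ∘ suc) g j

  splice-elim : ∀ {ℓ} (P : ℕ → A → Set ℓ) L Z g →
                (∀ i → i < L → P i (Z i)) → (∀ j → P (L + j) (g j)) → ∀ i → P i (splice L Z g i)
  splice-elim P zero    Z g lo hi i       = hi i
  splice-elim P (suc L) Z g lo hi zero    = lo zero (s≤s z≤n)
  splice-elim P (suc L) Z g lo hi (suc i) =
    splice-elim (P ∘ suc) L (Z ∘ suc) g (λ i i<L → lo (suc i) (s≤s i<L)) hi i

  extend : ∀ {m} → (Fin m → A) → A → ℕ → A
  extend {m} Z a i with i <? m
  ... | yes i<m = Z (fromℕ< i<m)
  ... | no _    = a

  extend-toℕ : ∀ {m} (Z : Fin m → A) a i → extend Z a (toℕ i) ≡ Z i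
  extend-toℕ {m} Z a i with toℕ i <? m
  ... | yes i<m = cong Z (fromℕ<-toℕ i i<m)
  ... | no  i≮m = ⊥-elim (i≮m (toℕ<n i))

members : ∀ {m} → Subset m → List (Fin m)
members []          = []ˡ
members (true ∷ p)  = zero ∷ˡ map suc (members p)
members (false ∷ p) = map suc (members p)

length-members : ∀ {m} (p : Subset m) → length (members p) ≡ ∣ p ∣
length-members []          = refl
length-members (true ∷ p)  = cong suc (trans (length-map suc (members p)) (length-members p))
length-members (false ∷ p) = trans (length-map suc (members p)) (length-members p)

∈⇒∈members : ∀ {m} {p : Subset m} {v} → v ∈ p → v ∈ˡ members p
∈⇒∈members {p = true ∷ p}  {zero}  _            = here refl
∈⇒∈members {p = true ∷ p}  {suc v} (thereᵛ v∈p) = there (∈-map⁺ suc (∈⇒∈members v∈p))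
∈⇒∈members {p = false ∷ p} {suc v} (thereᵛ v∈p) = ∈-map⁺ suc (∈⇒∈members v∈p)

module _ {n : ℕ} where

  record Coherent {ℓ} (Adj : Fin n → Fin n → Set ℓ) (T : CTree n) : Set ℓ where
    field
      bag-unique : ∀ {v} (p q : Pos T) → v ∈ C[ p ] → v ∈ C[ q ] → p ≡ q
      adj-anc    : ∀ {u v} (p q : Pos T) → Adj u v → u ∈ C[ p ] → v ∈ C[ q ] → Anc p q ⊎ Anc q p

  open Coherent

  coherent-child : ∀ {ℓ} {Adj : Fin n → Fin n → Set ℓ} {C k f} →
                   Coherent Adj (node C k f) → (c : Fin k) → Coherent Adj (f c)
  coherent-child coh c = record
    { bag-unique = λ p q u∈p u∈q → unchild (bag-unique coh (child c p) (child c q) u∈p u∈q)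
    ; adj-anc    = λ p q e u∈p v∈q → unchildAnc (adj-anc coh (child c p) (child c q) e u∈p v∈q)
    }
    where
      unchild : ∀ {p q} → child c p ≡ child c q → p ≡ q
      unchild refl = refl
      unchildAnc : ∀ {p q} → Anc (child c p) (child c q) ⊎ Anc (child c q) (child c p) →
                   Anc p q ⊎ Anc q p
      unchildAnc (inj₁ (anc-child a)) = inj₁ a
      unchildAnc (inj₂ (anc-child a)) = inj₂ a

  coherent-sub : ∀ {ℓ} {Adj : Fin n → Fin n → Set ℓ} {t} →
                 Coherent Adj t → (x : Pos t) → Coherent Adj (sub t x)
  coherent-sub coh here        = coh
  coherent-sub coh (child c x) = coherent-sub (coherent-child coh c) x

  coherent-same-child : ∀ {ℓ} {Adj : Fin n → Fin n → Set ℓ} {C k f} → Coherent Adj (node C k f) →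
                        ∀ {c c′ s s′} {q : Pos (f c)} {r : Pos (f c′)} →
                        s ∈ C[ q ] → s′ ≡ s ⊎ Adj s s′ → s′ ∈ C[ r ] → c′ ≡ c
  coherent-same-child coh {q = q} {r} s∈q (inj₁ refl) s∈r
    with bag-unique coh (child _ q) (child _ r) s∈q s∈r
  ... | refl = refl
  coherent-same-child coh {q = q} {r} s∈q (inj₂ e) s′∈r
    with adj-anc coh (child _ q) (child _ r) e s∈q s′∈r
  ... | inj₁ (anc-child _) = refl
  ... | inj₂ (anc-child _) = refl

  cutDecomposition-coherent : ∀ {G : Graph n} {t} → IsCutDecomposition G t → Coherent (Edge G) t
  cutDecomposition-coherent {G} {t} cd = record { bag-unique = unique ; adj-anc = anc }
    where
      open IsCutDecomposition cd
      unique : ∀ {v} (p q : Pos t) → v ∈ C[ p ] → v ∈ C[ q ] → p ≡ q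
      unique {v} p q v∈p v∈q =
        trans (proj₂ (proj₂ (unique-bag v)) p v∈p) (sym (proj₂ (proj₂ (unique-bag v)) q v∈q))
      anc : ∀ {u v} (p q : Pos t) → Edge G u v → u ∈ C[ p ] → v ∈ C[ q ] → Anc p q ⊎ Anc q p
      anc {u} {v} p q e u∈p v∈q with edge-anc u v e
      ... | p′ , q′ , u∈p′ , v∈q′ , comparable
        with unique p p′ u∈p u∈p′ | unique q q′ v∈q v∈q′
      ... | refl | refl = comparable

  localise : ∀ {t : CTree n} {x : Pos t} {v} → InΛ x v → Σ (Pos (sub t x)) λ p → v ∈ C[ p ]
  localise (q         , anc-here    , v∈q) = q , v∈q
  localise (child i q , anc-child a , v∈q) = localise (q , a , v∈q)

  bag≤load : ∀ (C : Subset n) k f → ∣ C ∣ ≤ load (node C k f)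
  bag≤load C zero    f = ≤-refl
  bag≤load C (suc k) f = m≤m+n _ _

  bag+child≤load : ∀ (C : Subset n) k f (c : Fin k) → ∣ C ∣ + load (f c) ≤ load (node C k f)
  bag+child≤load C (suc k) f c = +-monoʳ-≤ _ (maxF-upper (suc k) (λ i → load (f i)) c)

  module _ (D : ℕ) where

    factor : CTree n → ℕ
    factor (node C zero    f) = 1
    factor (node C (suc k) f) = maxF (suc k) (λ i → time D (f i))

    time≡factor* : ∀ (C : Subset n) k f →
                   time D (node C k f) ≡ factor (node C k f) * (∣ C ∣ * (D ∸ 1) + 1)
    time≡factor* C zero    f = sym (+-identityʳ _)
    time≡factor* C (suc k) f = refl

    time≤factor : ∀ (C : Subset n) k f (c : Fin k) → time D (f c) ≤ factor (node C k f)
    time≤factor C (suc k) f c = maxF-upper (suc k) (λ i → time D (f i)) c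

    mutual
      0<time : ∀ T → 0 < time D T
      0<time (node C k f) =
        subst (0 <_) (sym (time≡factor* C k f)) (lex-bound z≤n (0<factor (node C k f)))

      0<factor : ∀ T → 0 < factor T
      0<factor (node C zero    f) = s≤s z≤n
      0<factor (node C (suc k) f) = <-≤-trans (0<time (f zero)) (time≤factor C (suc k) f zero)

-- Distances

module _ {n : ℕ} (G : Graph n) where

  walk? : ∀ k u v → Dec (Walk G u v k)
  walk? zero u v with u ≟ᶠ v
  ... | yes refl = yes nil
  ... | no u≢v   = no λ { nil → u≢v refl }
  walk? (suc k) u v with any? (λ w → (Graph.adj G u w ≟ᵇ true) ×-dec walk? k w v)
  ... | yes (w , e , walk) = yes (cons e walk)
  ... | no ∄w              = no λ { (cons e walk) → ∄w (_ , e , walk) }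

  Dist-unique : ∀ {u v a b} → Dist G u v a → Dist G u v b → a ≡ b
  Dist-unique (wa , min-a) (wb , min-b) = ≤-antisym (min-a _ wb) (min-b _ wa)

  Dist-refl : ∀ {u} → Dist G u u 0
  Dist-refl = nil , λ _ _ → z≤n

  Dist-step : ∀ {z s d} → Dist G z s (suc d) → ∃ λ w → Edge G z w × Dist G w s d
  Dist-step (cons e walk , min) = _ , e , walk , λ j walk′ → ≤-pred (min (suc j) (cons e walk′))

  module Distance (connected : Connected G) where

    dist : Fin n → Fin n → ℕ
    dist u v = proj₁ (least-witness (λ k → walk? k u v) (proj₂ (connected u v)))

    dist-Dist : ∀ u v → Dist G u v (dist u v)
    dist-Dist u v = proj₂ (least-witness (λ k → walk? k u v) (proj₂ (connected u v)))

    dist≡0⇒≡ : ∀ {u v} → dist u v ≡ 0 → u ≡ v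
    dist≡0⇒≡ {u} {v} dist≡0 with dist u v | dist-Dist u v
    dist≡0⇒≡ refl | .0 | nil , _ = refl

    first-step : ∀ z s → z ≢ s → ∃ λ w → Edge G z w × ∃ λ d → Dist G w s d × Dist G z s (suc d)
    first-step z s z≢s with dist z s | dist-Dist z s
    ... | zero  | nil , _ = ⊥-elim (z≢s refl)
    ... | suc d | δ with Dist-step δ
    ...   | w , e , δw = w , e , d , δw , δ

    chase : Fin n → Fin n → Fin n
    chase z s with z ≟ᶠ s
    ... | yes _   = z
    ... | no z≢s  = proj₁ (first-step z s z≢s)

    chase-lazy : ∀ z s → LazyStep G s z (chase z s)
    chase-lazy z s with z ≟ᶠ s
    ... | yes _   = inj₁ refl
    ... | no z≢s  = inj₂ (proj₂ (first-step z s z≢s))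

    dist-chase : ∀ z s → dist (chase z s) s ≡ dist z s ∸ 1
    dist-chase z s with z ≟ᶠ s
    ... | yes refl = trans dist≡0 (cong (_∸ 1) (sym dist≡0))
      where
        dist≡0 : dist z z ≡ 0
        dist≡0 = Dist-unique (dist-Dist z z) Dist-refl
    ... | no z≢s with first-step z s z≢s
    ...   | w , _ , d , δw , δz = trans (Dist-unique (dist-Dist w s) δw)
                                        (cong (_∸ 1) (Dist-unique δz (dist-Dist z s)))

-- Winning by a potential function

module _ {n : ℕ} (G : Graph n) (R : Fin n → Set) {m : ℕ} where

  captured⇒Win : ∀ k {Z : Fin m → Fin n} {s} → Captured G Z s → Win G R m k Z s
  captured⇒Win zero    caught = caught
  captured⇒Win (suc k) caught = inj₁ caught

  Win-cong : ∀ k {Z Z′ : Fin m → Fin n} {s} → Z ≗ Z′ → Win G R m k Z s → Win G R m k Z′ s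
  Win-cong zero    Z≗Z′ (i , Zi≡s)        = i , trans (sym (Z≗Z′ i)) Zi≡s
  Win-cong (suc k) Z≗Z′ (inj₁ (i , Zi≡s)) = inj₁ (i , trans (sym (Z≗Z′ i)) Zi≡s)
  Win-cong (suc k) {s = s} Z≗Z′ (inj₂ (Z″ , lazy , rest)) =
    inj₂ (Z″ , (λ i → subst (λ z → LazyStep G s z (Z″ i)) (Z≗Z′ i) (lazy i)) , rest)

  module PotentialArgument
    {Cfg : Set} (zombies : Cfg → Fin m → Fin n)
    (potential : Cfg → ∀ s → R s → ℕ)
    (move : Cfg → ∀ s → R s → Cfg)
    (move-lazy : ∀ Z s r i → LazyStep G s (zombies Z i) (zombies (move Z s r) i))
    (move-progress : ∀ Z s r →
       Captured G (zombies (move Z s r)) s ⊎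
       (∀ s′ → SurvStep G s s′ → (r′ : R s′) →
          Captured G (zombies (move Z s r)) s′ ⊎ potential (move Z s r) s′ r′ < potential Z s r))
    where

    win : ∀ k Z s (r : R s) → potential Z s r < k → Win G R m k (zombies Z) s
    win (suc k) Z s r Φ<1+k with move-progress Z s r
    ... | inj₁ caught = inj₂ (zombies (move Z s r) , move-lazy Z s r , inj₁ caught)
    ... | inj₂ reply  = inj₂ (zombies (move Z s r) , move-lazy Z s r , inj₂ respond)
      where
        respond : ∀ s′ → SurvStep G s s′ → R s′ → Win G R m k (zombies (move Z s r)) s′
        respond s′ step r′ with reply s′ step r′
        ... | inj₁ caught = captured⇒Win k caught
        ... | inj₂ Φ′<Φ   = win k (move Z s r) s′ r′ (<-≤-trans Φ′<Φ (≤-pred Φ<1+k))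

-- The pursuit strategy

module Strategy {n : ℕ} (G : Graph n) (connected : Connected G) (D : ℕ) (diameter : Diameter G D) where

  open Distance G connected

  Caught : ℕ → (ℕ → Fin n) → Fin n → Set
  Caught m Z s = ∃ λ i → i < m × Z i ≡ s

  Caught-mono : ∀ {m m′ Z s} → m ≤ m′ → Caught m Z s → Caught m′ Z s
  Caught-mono m≤m′ (i , i<m , Zi≡s) = i , <-≤-trans i<m m≤m′ , Zi≡s

  Caught-splice : ∀ L {m Z g s} → Caught m g s → Caught (L + m) (splice L Z g) s
  Caught-splice L {Z = Z} {g} (j , j<m , gj≡s) =
    L + j , +-monoʳ-< L j<m , trans (shift-splice L Z g j) gj≡s

  Caught⇒Captured : ∀ {m Z s} → Caught m Z s → Captured G (λ (i : Fin m) → Z (toℕ i)) s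
  Caught⇒Captured {Z = Z} (i , i<m , Zi≡s) = fromℕ< i<m , trans (cong Z (toℕ-fromℕ< i<m)) Zi≡s

  slack : Fin n → Fin n → ℕ
  slack z c = dist z c ∸ 1

  slack≤ : ∀ z c → slack z c ≤ D ∸ 1
  slack≤ z c = ∸-monoˡ-≤ 1 (proj₁ diameter z c _ (dist-Dist z c))

  slack-chase-≤ : ∀ z s → slack (chase z s) s ≤ slack z s
  slack-chase-≤ z s = subst (slack (chase z s) s ≤_) (dist-chase z s) (m∸n≤m _ 1)

  slack-chase-< : ∀ z s → chase z s ≢ s → slack (chase z s) s < slack z s
  slack-chase-< z s chase≢s =
    subst (slack (chase z s) s <_) (dist-chase z s)
      (∸-monoʳ-< (s≤s z≤n) (n≢0⇒n>0 (chase≢s ∘ dist≡0⇒≡)))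

  guard : Fin n → Fin n → Fin n → Fin n
  guard c s z with c ≟ᶠ s
  ... | yes _ = chase z s
  ... | no _  = z

  guard-self : ∀ s z → guard s s z ≡ chase z s
  guard-self s z with s ≟ᶠ s
  ... | yes _  = refl
  ... | no s≢s = ⊥-elim (s≢s refl)

  guard-lazy : ∀ c s z → LazyStep G s z (guard c s z)
  guard-lazy c s z with c ≟ᶠ s
  ... | yes _ = chase-lazy z s
  ... | no _  = inj₁ refl

  slack-guard-≤ : ∀ c s z → slack (guard c s z) c ≤ slack z c
  slack-guard-≤ c s z with c ≟ᶠ s
  ... | yes refl = slack-chase-≤ z c
  ... | no _     = ≤-refl

  pursue : List (Fin n) → Fin n → (ℕ → Fin n) → ℕ → Fin n
  pursue []ˡ       s Z         = Z
  pursue (c ∷ˡ cs) s Z zero    = guard c s (Z zero)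
  pursue (c ∷ˡ cs) s Z (suc i) = pursue cs s (Z ∘ suc) i

  Φ : List (Fin n) → (ℕ → Fin n) → ℕ
  Φ []ˡ       Z = 0
  Φ (c ∷ˡ cs) Z = slack (Z zero) c + Φ cs (Z ∘ suc)

  pursue-lazy : ∀ cs s Z i → LazyStep G s (Z i) (pursue cs s Z i)
  pursue-lazy []ˡ       s Z i       = inj₁ refl
  pursue-lazy (c ∷ˡ cs) s Z zero    = guard-lazy c s (Z zero)
  pursue-lazy (c ∷ˡ cs) s Z (suc i) = pursue-lazy cs s (Z ∘ suc) i

  Φ-pursue-≤ : ∀ cs s Z → Φ cs (pursue cs s Z) ≤ Φ cs Z
  Φ-pursue-≤ []ˡ       s Z = ≤-refl
  Φ-pursue-≤ (c ∷ˡ cs) s Z = +-mono-≤ (slack-guard-≤ c s (Z zero)) (Φ-pursue-≤ cs s (Z ∘ suc))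

  Φ-cong : ∀ cs {Z Z′} → (∀ i → i < length cs → Z i ≡ Z′ i) → Φ cs Z ≡ Φ cs Z′
  Φ-cong []ˡ       Z≡Z′ = refl
  Φ-cong (c ∷ˡ cs) Z≡Z′ =
    cong₂ _+_ (cong (λ z → slack z c) (Z≡Z′ zero (s≤s z≤n)))
              (Φ-cong cs (λ i i<l → Z≡Z′ (suc i) (s≤s i<l)))

  Φ≤ : ∀ cs Z → Φ cs Z ≤ length cs * (D ∸ 1)
  Φ≤ []ˡ       Z = z≤n
  Φ≤ (c ∷ˡ cs) Z = +-mono-≤ (slack≤ (Z zero) c) (Φ≤ cs (Z ∘ suc))

  pursue-progress : ∀ cs s Z → s ∈ˡ cs →
                    Caught (length cs) (pursue cs s Z) s ⊎ Φ cs (pursue cs s Z) < Φ cs Z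
  pursue-progress (s ∷ˡ cs) s Z (here refl) with chase (Z zero) s ≟ᶠ s
  ... | yes caught   = inj₁ (0 , s≤s z≤n , trans (guard-self s (Z zero)) caught)
  ... | no uncaught  = inj₂ (+-mono-<-≤
          (subst (λ z → slack z s < slack (Z zero) s) (sym (guard-self s (Z zero)))
                 (slack-chase-< (Z zero) s uncaught))
          (Φ-pursue-≤ cs s (Z ∘ suc)))
  pursue-progress (c ∷ˡ cs) s Z (there s∈cs) with pursue-progress cs s (Z ∘ suc) s∈cs
  ... | inj₁ (i , i<l , caught) = inj₁ (suc i , s≤s i<l , caught)
  ... | inj₂ Φ′<Φ               = inj₂ (+-mono-≤-< (slack-guard-≤ c s (Z zero)) Φ′<Φ)

  -- zombies 0 .. |C| − 1 guard the bag C of the root, the others are handed to the child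
  -- subtree containing the survivor
  strategy : (T : CTree n) → Pos T → Fin n → (ℕ → Fin n) → ℕ → Fin n
  strategy (node C k f) here        s Z = pursue (members C) s Z
  strategy (node C k f) (child c q) s Z = splice ∣ C ∣ Z (strategy (f c) q s (shift ∣ C ∣ Z))

  mutual
    potential : (T : CTree n) → (ℕ → Fin n) → Pos T → ℕ
    potential T@(node C k f) Z p = Φ (members C) Z * factor D T + potential↓ T Z p

    potential↓ : (T : CTree n) → (ℕ → Fin n) → Pos T → ℕ
    potential↓ (node C k f) Z here        = 0
    potential↓ (node C k f) Z (child c q) = potential (f c) (shift ∣ C ∣ Z) q

  strategy-lazy : ∀ T p s Z i → LazyStep G s (Z i) (strategy T p s Z i)
  strategy-lazy (node C k f) here        s Z = pursue-lazy (members C) s Z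
  strategy-lazy (node C k f) (child c q) s Z =
    splice-elim (λ i z → LazyStep G s (Z i) z) ∣ C ∣ Z _
      (λ _ _ → inj₁ refl) (strategy-lazy (f c) q s (shift ∣ C ∣ Z))

  potential-cong : ∀ T p {Z Z′} → Z ≗ Z′ → potential T Z p ≡ potential T Z′ p
  potential-cong (node C k f) p {Z} {Z′} Z≗Z′ =
    cong₂ _+_ (cong (_* factor D (node C k f)) (Φ-cong (members C) (λ i _ → Z≗Z′ i))) (below p)
    where
      below : ∀ p → potential↓ (node C k f) Z p ≡ potential↓ (node C k f) Z′ p
      below here        = refl
      below (child c q) = potential-cong (f c) q (Z≗Z′ ∘ (∣ C ∣ +_))

  Φ-members≤ : ∀ C Z → Φ (members C) Z ≤ ∣ C ∣ * (D ∸ 1)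
  Φ-members≤ C Z = subst (λ l → Φ (members C) Z ≤ l * (D ∸ 1)) (length-members C) (Φ≤ (members C) Z)

  mutual
    potential↓<factor : ∀ T Z p → potential↓ T Z p < factor D T
    potential↓<factor (node C k f) Z here        = 0<factor D (node C k f)
    potential↓<factor (node C k f) Z (child c q) =
      <-≤-trans (potential<time (f c) (shift ∣ C ∣ Z) q) (time≤factor D C k f c)

    potential<time : ∀ T Z p → potential T Z p < time D T
    potential<time (node C k f) Z p =
      subst (potential (node C k f) Z p <_) (sym (time≡factor* D C k f))
        (lex-bound (Φ-members≤ C Z) (potential↓<factor (node C k f) Z p))

  -- The positivity of the potential is what lets it drop when the survivor climbs from a child's
  -- subtree into the bag of the root.
  Progress : (T : CTree n) → (ℕ → Fin n) → Pos T → Fin n → Set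
  Progress T Z p s =
    Caught (load T) Z′ s ⊎
    (0 < potential T Z p ×
     (∀ s′ q → SurvStep G s s′ → s′ ∈ C[ q ] → Caught (load T) Z′ s′ ⊎ potential T Z′ q < potential T Z p))
    where
      Z′ : ℕ → Fin n
      Z′ = strategy T p s Z

  Caught-child : ∀ {C : Subset n} {k f} (c : Fin k) {Z g s} →
                 Caught (load (f c)) g s → Caught (load (node C k f)) (splice ∣ C ∣ Z g) s
  Caught-child {C} {k} {f} c = Caught-mono (bag+child≤load C k f c) ∘ Caught-splice ∣ C ∣

  progress-root : ∀ C k f Z s → s ∈ C → Progress (node C k f) Z here s
  progress-root C k f Z s s∈C with pursue-progress (members C) s Z (∈⇒∈members s∈C)
  ... | inj₁ caught =
    inj₁ (Caught-mono (≤-trans (≤-reflexive (length-members C)) (bag≤load C k f)) caught)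
  ... | inj₂ Φ′<Φ   = inj₂ (≤-<-trans z≤n (decrease here) , λ _ q _ _ → inj₂ (decrease q))
    where
      T : CTree n
      T = node C k f
      decrease : ∀ q → potential T (pursue (members C) s Z) q < potential T Z here
      decrease q = lex-< 0 Φ′<Φ (potential↓<factor T _ q)

  progress-child : ∀ {C k f} → Coherent (Edge G) (node C k f) → ∀ {c q} Z s → s ∈ C[ q ] →
                   Progress (f c) (shift ∣ C ∣ Z) q s → Progress (node C k f) Z (child c q) s
  progress-child coh {c} Z s s∈q (inj₁ caught) = inj₁ (Caught-child c caught)
  progress-child {C} {k} {f} coh {c} {q} Z s s∈q (inj₂ (pos , reply)) =
    inj₂ (<-≤-trans pos (m≤n+m _ _) , reply′)
    where
      T : CTree n
      T = node C k f
      g Z′ : ℕ → Fin n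
      g = strategy (f c) q s (shift ∣ C ∣ Z)
      Z′ = splice ∣ C ∣ Z g
      root-unmoved : Φ (members C) Z′ ≡ Φ (members C) Z
      root-unmoved = Φ-cong (members C) λ i i<l →
        splice-< ∣ C ∣ Z g (subst (i <_) (length-members C) i<l)
      below : ∀ {b b′} → b < b′ → Φ (members C) Z′ * factor D T + b < Φ (members C) Z * factor D T + b′
      below {b} {b′} b<b′ = subst (λ a → a * factor D T + b < Φ (members C) Z * factor D T + b′)
        (sym root-unmoved) (+-monoʳ-< _ b<b′)
      reply′ : ∀ s′ q′ → SurvStep G s s′ → s′ ∈ C[ q′ ] →
               Caught (load T) Z′ s′ ⊎ potential T Z′ q′ < potential T Z (child c q)
      reply′ s′ here         step s′∈q′ = inj₂ (below pos)
      reply′ s′ (child c′ r) step s′∈r with coherent-same-child coh {q = q} {r} s∈q step s′∈r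
      ... | refl with reply s′ r step s′∈r
      ...   | inj₁ caught = inj₁ (Caught-child c caught)
      ...   | inj₂ Φ′<Φ   =
        inj₂ (below (subst (_< _) (sym (potential-cong (f c) r (shift-splice ∣ C ∣ Z g))) Φ′<Φ))

  progress : ∀ T → Coherent (Edge G) T → ∀ Z p s → s ∈ C[ p ] → Progress T Z p s
  progress (node C k f) coh Z here        s s∈C = progress-root C k f Z s s∈C
  progress (node C k f) coh Z (child c q) s s∈q =
    progress-child coh Z s s∈q (progress (f c) (coherent-child coh c) (shift ∣ C ∣ Z) q s s∈q)

  module Confined (t : CTree n) (cd : IsCutDecomposition G t) (x : Pos t) where

    private
      T : CTree n
      T = sub t x

      position : ∀ {s} → InΛ x s → Pos T
      position r = proj₁ (localise r)

      zombies : (ℕ → Fin n) → Fin (load T) → Fin n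
      zombies Z i = Z (toℕ i)

      coherent : Coherent (Edge G) T
      coherent = coherent-sub (cutDecomposition-coherent cd) x

    move-progress : ∀ Z s (r : InΛ x s) →
      Captured G (zombies (strategy T (position r) s Z)) s ⊎
      (∀ s′ → SurvStep G s s′ → (r′ : InΛ x s′) →
         Captured G (zombies (strategy T (position r) s Z)) s′ ⊎
         potential T (strategy T (position r) s Z) (position r′) < potential T Z (position r))
    move-progress Z s r with progress T coherent Z (position r) s (proj₂ (localise r))
    ... | inj₁ caught      = inj₁ (Caught⇒Captured caught)
    ... | inj₂ (_ , reply) =
      inj₂ λ s′ step r′ → map₁ Caught⇒Captured (reply s′ (position r′) step (proj₂ (localise r′)))

    open PotentialArgument G (InΛ x) zombies
      (λ Z s r → potential T Z (position r))
      (λ Z s r → strategy T (position r) s Z)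
      (λ Z s r i → strategy-lazy T (position r) s Z (toℕ i))
      move-progress
      public

theorem7 : ∀ (n : ℕ) (G : Graph n) → Connected G →
           (t : CTree n) → IsCutDecomposition G t →
           (D : ℕ) → Diameter G D →
           (x : Pos t) →
           (Z : Fin (load (sub t x)) → Fin n) → (s : Fin n) → InΛ x s →
           Win G (InΛ x) (load (sub t x)) (time D (sub t x)) Z s
theorem7 n G connected t cd D diameter x Z s s∈Λ =
  Win-cong G (InΛ x) (time D (sub t x)) (extend-toℕ Z s)
    (win (time D (sub t x)) (extend Z s) s s∈Λ
      (potential<time (sub t x) (extend Z s) (proj₁ (localise s∈Λ))))
  where
    open Strategy G connected D diameter
    open Confined t cd x
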